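{- For every integer $n \geq 3$, the McPherson number of the path $P_n$ on $n$ vertices is $\Upsilon(P_n) = n-2$.
   Context: Vertex explosions: start with $G'_0 = G$ (with underlying graph $G^*_0 = G$). Given the mixed graph $G'_i$ (the graph $G$ together with the arcs added so far) with underlying simple graph $G^*_i$, exploding a vertex $w$ produces $G'_{i+1}$ by adding an arc $(w,z)$ for every vertex $z \neq w$ that is not adjacent to $w$ in $G^*_i$. The McPherson number $\Upsilon(G)$ of a graph $G$ on $n$ vertices is the minimum number $\ell$ of successive vertex explosions after which the underlying graph $G^*_\ell$ is isomorphic to the complete graph $K_n$. -}

module Defs where

open import Data.Nat using (ℕ; _+_; _≤_; _≡ᵇ_)
open import Data.Fin using (Fin; toℕ; _≟_)
open import Data.Bool using (Bool; true; false; _∨_; _∧_; not)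
open import Data.List using (List; foldl; length)
open import Data.Product using (Σ; _×_; ∃-syntax)
open import Relation.Nullary using (does)
open import Relation.Binary.PropositionalEquality using (_≡_; _≢_)

-- A (simple) graph on the vertex set Fin n, given by its Boolean adjacency
-- relation (the underlying simple graph G*; arc directions are irrelevant
-- for the McPherson number, which only looks at the underlying graph).
Adj : ℕ → Set
Adj n = Fin n → Fin n → Bool

_=ᵥ_ : ∀ {n} → Fin n → Fin n → Bool
x =ᵥ y = does (x ≟ y)

-- Underlying graph after exploding w: w becomes adjacent to every other vertex
-- (an arc (w,z) is added for each z ≠ w not adjacent to w).
explode : ∀ {n} → Adj n → Fin n → Adj n
explode adj w x y =
  adj x y ∨ ((x =ᵥ w) ∧ not (y =ᵥ w)) ∨ ((y =ᵥ w) ∧ not (x =ᵥ w))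

explodeAll : ∀ {n} → Adj n → List (Fin n) → Adj n
explodeAll = foldl explode

-- The underlying graph is complete, i.e. equal (hence isomorphic) to K_n
-- on the same vertex set.
IsComplete : ∀ {n} → Adj n → Set
IsComplete {n} adj = (x y : Fin n) → x ≢ y → adj x y ≡ true

IsMcPhersonNumber : ∀ {n} → Adj n → ℕ → Set
IsMcPhersonNumber {n} G ℓ =
  (∃[ ws ] (length ws ≡ ℓ × IsComplete (explodeAll G ws)))
  × ((ws : List (Fin n)) → IsComplete (explodeAll G ws) → ℓ ≤ length ws)

path : (n : ℕ) → Adj n
path n i j = ((toℕ i + 1) ≡ᵇ toℕ j) ∨ ((toℕ j + 1) ≡ᵇ toℕ i)

-- Exploding w makes w adjacent to everything, so after exploding the vertices ws
-- the underlying graph is complete iff the unexploded vertices already form a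
-- clique in G. A clique meets each colour class of a proper colouring at most
-- once, so for a k-colourable graph at least n - k explosions are needed; the
-- path is 2-coloured by parity. Conversely, exploding every vertex but the
-- adjacent pair 0, 1 of the path completes it with n - 2 explosions.
module Submission where

open import Defs
open import Data.Nat using (ℕ; zero; suc; _+_; _∸_; _≤_; s≤s)
open import Data.Nat.Properties using (≡ᵇ⇒≡; +-comm; m≤n+o⇒m∸n≤o)
open import Data.Fin using (Fin; toℕ; _≟_; join; splitAt)
open import Data.Fin.Properties using (splitAt-join; injective⇒≤)
open import Data.Bool using (true; false)
open import Data.Bool.Properties using (T-∨; T-≡)
open import Data.List using (List; []; _∷_; length; map; allFin; lookup)
open import Data.List.Properties using (length-map; length-tabulate)
open import Data.List.Relation.Unary.Any as Any using (here; there)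
open import Data.List.Relation.Unary.Any.Properties using (lookup-index)
open import Data.List.Membership.Propositional using (_∈_; _∉_)
open import Data.List.Membership.Propositional.Properties using (∈-map⁺; ∈-allFin)
open import Data.Product using (_,_)
open import Data.Sum as Sum using (_⊎_; inj₁; inj₂; [_,_]′)
open import Data.Sum.Properties using (inj₁-injective; inj₂-injective)
open import Data.Empty using (⊥-elim)
open import Function using (id; _∘_; Equivalence)
open import Function.Definitions using (Injective)
open import Relation.Nullary using (Dec; yes; no; contradiction)
open import Relation.Binary.PropositionalEquality

private
  variable
    n k : ℕ

_∈?_ : (v : Fin n) (ws : List (Fin n)) → Dec (v ∈ ws)
v ∈? ws = Any.any? (v ≟_) ws

IsClique : Adj n → (Fin n → Set) → Set
IsClique {n} G P = (x y : Fin n) → x ≢ y → P x → P y → G x y ≡ true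

IsProperColouring : Adj n → (Fin n → Fin k) → Set
IsProperColouring {n} G c = (x y : Fin n) → G x y ≡ true → c x ≢ c y

module _ (G : Adj n) where

  explode-preserves : ∀ w {x y} → G x y ≡ true → explode G w x y ≡ true
  explode-preserves w e rewrite e = refl

  explode-joins : ∀ w {x y} → x ≢ y → x ≡ w ⊎ y ≡ w → explode G w x y ≡ true
  explode-joins w {x} {y} x≢y hit with G x y | x ≟ w | y ≟ w
  ... | true  | _       | _       = refl
  ... | false | yes x≡w | yes y≡w = contradiction (trans x≡w (sym y≡w)) x≢y
  ... | false | yes _   | no _    = refl
  ... | false | no _    | yes _   = refl
  ... | false | no x≢w  | no y≢w  = ⊥-elim ([ x≢w , y≢w ]′ hit)

  explode-edge : ∀ w {x y} → explode G w x y ≡ true → G x y ≡ true ⊎ x ≡ w ⊎ y ≡ w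
  explode-edge w {x} {y} e with G x y | x ≟ w | y ≟ w
  ... | true  | _       | _       = inj₁ refl
  ... | false | yes x≡w | _       = inj₂ (inj₁ x≡w)
  ... | false | no _    | yes y≡w = inj₂ (inj₂ y≡w)
  ... | false | no _    | no _    with () ← e

explodeAll-preserves : (G : Adj n) (ws : List (Fin n)) {x y : Fin n} →
                       G x y ≡ true → explodeAll G ws x y ≡ true
explodeAll-preserves G []       e = e
explodeAll-preserves G (w ∷ ws) e = explodeAll-preserves (explode G w) ws (explode-preserves G w e)

explodeAll-joins : (G : Adj n) (ws : List (Fin n)) {x y : Fin n} →
                   x ≢ y → x ∈ ws ⊎ y ∈ ws → explodeAll G ws x y ≡ true
explodeAll-joins G (w ∷ ws) x≢y (inj₁ (here x≡w)) =
  explodeAll-preserves (explode G w) ws (explode-joins G w x≢y (inj₁ x≡w))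
explodeAll-joins G (w ∷ ws) x≢y (inj₂ (here y≡w)) =
  explodeAll-preserves (explode G w) ws (explode-joins G w x≢y (inj₂ y≡w))
explodeAll-joins G (w ∷ ws) x≢y (inj₁ (there x∈ws)) = explodeAll-joins (explode G w) ws x≢y (inj₁ x∈ws)
explodeAll-joins G (w ∷ ws) x≢y (inj₂ (there y∈ws)) = explodeAll-joins (explode G w) ws x≢y (inj₂ y∈ws)

explodeAll-edge : (G : Adj n) (ws : List (Fin n)) {x y : Fin n} →
                  explodeAll G ws x y ≡ true → G x y ≡ true ⊎ x ∈ ws ⊎ y ∈ ws
explodeAll-edge G []       e = inj₁ e
explodeAll-edge G (w ∷ ws) e with explodeAll-edge (explode G w) ws e
... | inj₂ (inj₁ x∈ws) = inj₂ (inj₁ (there x∈ws))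
... | inj₂ (inj₂ y∈ws) = inj₂ (inj₂ (there y∈ws))
... | inj₁ e′ = Sum.map₂ (Sum.map here here) (explode-edge G w e′)

complete⇒clique-∉ : (G : Adj n) (ws : List (Fin n)) →
                     IsComplete (explodeAll G ws) → IsClique G (_∉ ws)
complete⇒clique-∉ G ws complete x y x≢y x∉ws y∉ws
  with explodeAll-edge G ws (complete x y x≢y)
... | inj₁ e           = e
... | inj₂ (inj₁ x∈ws) = contradiction x∈ws x∉ws
... | inj₂ (inj₂ y∈ws) = contradiction y∈ws y∉ws

clique-∉⇒complete : (G : Adj n) (ws : List (Fin n)) →
                     IsClique G (_∉ ws) → IsComplete (explodeAll G ws)
clique-∉⇒complete G ws clique x y x≢y with x ∈? ws | y ∈? ws
... | yes x∈ws | _        = explodeAll-joins G ws x≢y (inj₁ x∈ws)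
... | no _     | yes y∈ws = explodeAll-joins G ws x≢y (inj₂ y∈ws)
... | no x∉ws  | no y∉ws  = explodeAll-preserves G ws (clique x y x≢y x∉ws y∉ws)

-- Exploded vertices are coded by their position in ws, the others by their
-- colour; on a clique the colour is injective.
module _ {G : Adj n} {c : Fin n → Fin k} (proper : IsProperColouring G c)
         (ws : List (Fin n)) (clique : IsClique G (_∉ ws)) where

  private
    code : (v : Fin n) → Dec (v ∈ ws) → Fin (length ws) ⊎ Fin k
    code v (yes v∈ws) = inj₁ (Any.index v∈ws)
    code v (no _)     = inj₂ (c v)

    code-injective : ∀ {u v} (du : Dec (u ∈ ws)) (dv : Dec (v ∈ ws)) →
                     code u du ≡ code v dv → u ≡ v
    code-injective (yes u∈ws) (yes v∈ws) e =
      trans (lookup-index u∈ws) (trans (cong (lookup ws) (inj₁-injective e)) (sym (lookup-index v∈ws)))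
    code-injective {u} {v} (no u∉ws) (no v∉ws) e with u ≟ v
    ... | yes u≡v = u≡v
    ... | no u≢v  = contradiction (inj₂-injective e) (proper u v (clique u v u≢v u∉ws v∉ws))

    encode : Fin n → Fin (length ws + k)
    encode v = join (length ws) k (code v (v ∈? ws))

    encode-injective : Injective _≡_ _≡_ encode
    encode-injective {u} {v} e =
      code-injective (u ∈? ws) (v ∈? ws)
        (trans (sym (splitAt-join (length ws) k (code u (u ∈? ws))))
               (trans (cong (splitAt (length ws)) e) (splitAt-join (length ws) k (code v (v ∈? ws)))))

  clique-∉⇒n≤length+colours : n ≤ length ws + k
  clique-∉⇒n≤length+colours = injective⇒≤ encode-injective

parity : ℕ → Fin 2
parity zero          = Fin.zero
parity (suc zero)    = Fin.suc Fin.zero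
parity (suc (suc m)) = parity m

parity-suc : ∀ m → parity (suc m) ≢ parity m
parity-suc zero          ()
parity-suc (suc zero)    ()
parity-suc (suc (suc m)) = parity-suc m

path-adjacent : (i j : Fin n) → path n i j ≡ true → toℕ i + 1 ≡ toℕ j ⊎ toℕ j + 1 ≡ toℕ i
path-adjacent i j e =
  Sum.map (≡ᵇ⇒≡ _ _) (≡ᵇ⇒≡ _ _) (Equivalence.to T-∨ (Equivalence.from T-≡ e))

path-parity-proper : ∀ n → IsProperColouring (path n) (parity ∘ toℕ)
path-parity-proper n i j e with path-adjacent i j e
... | inj₁ i+1≡j = λ same → parity-suc (toℕ i) (trans (cong parity (trans (+-comm 1 (toℕ i)) i+1≡j)) (sym same))
... | inj₂ j+1≡i = λ same → parity-suc (toℕ j) (trans (cong parity (trans (+-comm 1 (toℕ j)) j+1≡i)) same)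

path-lower-bound : ∀ n (ws : List (Fin n)) → IsComplete (explodeAll (path n) ws) → n ∸ 2 ≤ length ws
path-lower-bound n ws complete =
  m≤n+o⇒m∸n≤o n 2 (subst (n ≤_) (+-comm (length ws) 2)
    (clique-∉⇒n≤length+colours (path-parity-proper n) ws (complete⇒clique-∉ (path n) ws complete)))

allButFirstTwo : ∀ m → List (Fin (suc (suc m)))
allButFirstTwo m = map (Fin.suc ∘ Fin.suc) (allFin m)

length-allButFirstTwo : ∀ m → length (allButFirstTwo m) ≡ m
length-allButFirstTwo m = trans (length-map _ (allFin m)) (length-tabulate id)

path-clique-∉-allButFirstTwo : ∀ m → IsClique (path (suc (suc m))) (_∉ allButFirstTwo m)
path-clique-∉-allButFirstTwo m Fin.zero              Fin.zero              x≢y _  _  = contradiction refl x≢y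
path-clique-∉-allButFirstTwo m Fin.zero              (Fin.suc Fin.zero)    _   _  _  = refl
path-clique-∉-allButFirstTwo m (Fin.suc Fin.zero)    Fin.zero              _   _  _  = refl
path-clique-∉-allButFirstTwo m (Fin.suc Fin.zero)    (Fin.suc Fin.zero)    x≢y _  _  = contradiction refl x≢y
path-clique-∉-allButFirstTwo m (Fin.suc (Fin.suc i)) _                     _   x∉ _  = contradiction (∈-map⁺ _ (∈-allFin i)) x∉
path-clique-∉-allButFirstTwo m _                     (Fin.suc (Fin.suc j)) _   _  y∉ = contradiction (∈-map⁺ _ (∈-allFin j)) y∉

proposition2p4 : (n : ℕ) → 3 ≤ n → IsMcPhersonNumber (path n) (n ∸ 2)
proposition2p4 (suc (suc m)) _ =
  ( allButFirstTwo m
  , length-allButFirstTwo m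
  , clique-∉⇒complete (path (suc (suc m))) (allButFirstTwo m) (path-clique-∉-allButFirstTwo m))
  , path-lower-bound (suc (suc m))
proposition2p4 (suc zero) (s≤s ())
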